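{- Let $D=(b_1,\dots,b_N)$ be a general Dyck path, let $R^{(0)}$ be its canonical rank sequence, and let $\widetilde R$ be the rank sequence of the increasing balanced path diagram output by Algorithm VIB started from $T(D,R^{(0)})$. If $R$ is any weakly increasing sequence with $R^{(0)}\preceq R\preceq\widetilde R$, then Algorithm VIB started from $T(D,R)$ outputs the rank sequence $\widetilde R$.
   Context: A path diagram $T(D,R)$, $R=(r_1,\dots,r_N)$, consists of arrows $A_i=(1,b_i)$ starting at $(i,r_i)$ with end rank $r_i+b_i$. Red arrow: $b_i>0$, segment in row $j$ (strip between heights $j,j+1$) iff $r_i\le j\le r_i+b_i-1$; blue: $b_i<0$, segment in row $j$ iff $r_i+b_i\le j\le r_i-1$. Row count $c(j)$ = #red minus #blue segments in row $j$; balanced: all $c(j)=0$. A general Dyck path has sum $0$ and nonnegative partial sums $b_1+\dots+b_{i-1}$. The canonical (minimal) rank sequence $R^{(0)}$ of $D$ is given by $r_1=\max\{0,-b_1\}$ and $r_{i+1}=\max\{r_i,-b_{i+1}\}$. For rank sequences, $R\preceq R'$ means $r_i\le r_i'$ for all $i$. Algorithm VIB on $T(D,R)$ with $R$ weakly increasing: repeat: if all row counts are $\le0$, stop and output the current rank sequence; otherwise find the lowest row $j$ with $c(j)>0$, find the rightmost arrow starting at level $j$, say $A_i$, and increase $r_i$ by $1$. -}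

module Defs where

open import Data.Nat using (ℕ)
open import Data.Integer using (ℤ; 0ℤ; 1ℤ; -1ℤ; _+_; _-_; -_; _≤_; _<_; _≤?_; _<?_; _⊔_)
open import Data.Fin using (Fin) renaming (_<_ to _<ᶠ_; _≤_ to _≤ᶠ_)
open import Data.Vec using (Vec; []; _∷_; lookup; zipWith; toList; updateAt)
open import Data.List using (List; take; foldr)
open import Data.Bool using (Bool; true; false; if_then_else_; _∧_)
open import Data.Product using (Σ; _×_)
open import Relation.Nullary using (¬_; does)
open import Relation.Binary.PropositionalEquality using (_≡_; _≢_)

sumℤ : List ℤ → ℤ
sumℤ = foldr _+_ 0ℤ

-- General Dyck path D = (b_1,…,b_N): nonzero integer steps (each arrow is
-- red or blue), total sum 0, all partial sums b_1+…+b_k nonnegative.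
IsGeneralDyck : ∀ {N} → Vec ℤ N → Set
IsGeneralDyck {N} b =
  (∀ (i : Fin N) → lookup b i ≢ 0ℤ) ×
  (sumℤ (toList b) ≡ 0ℤ) ×
  (∀ (k : ℕ) → 0ℤ ≤ sumℤ (take k (toList b)))

-- contribution of arrow (1,b) starting at rank r to the row j
-- (strip between heights j and j+1): +1 for a red segment, -1 for a blue one.
segment : ℤ → ℤ → ℤ → ℤ
segment b r j =
  if does (0ℤ <? b)
    then (if does (r ≤? j) ∧ does (j ≤? (r + b - 1ℤ)) then 1ℤ else 0ℤ)
    else (if does (b <? 0ℤ)
            then (if does ((r + b) ≤? j) ∧ does (j ≤? (r - 1ℤ)) then -1ℤ else 0ℤ)
            else 0ℤ)

rowCount : ∀ {N} → Vec ℤ N → Vec ℤ N → ℤ → ℤ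
rowCount b R j = sumℤ (toList (zipWith (λ bi ri → segment bi ri j) b R))

canonGo : ∀ {N} → ℤ → Vec ℤ N → Vec ℤ N
canonGo acc [] = []
canonGo acc (b ∷ bs) = (acc ⊔ (- b)) ∷ canonGo (acc ⊔ (- b)) bs

canonical : ∀ {N} → Vec ℤ N → Vec ℤ N
canonical = canonGo 0ℤ

_⪯_ : ∀ {N} → Vec ℤ N → Vec ℤ N → Set
_⪯_ {N} R R' = ∀ (i : Fin N) → lookup R i ≤ lookup R' i

WeaklyIncreasing : ∀ {N} → Vec ℤ N → Set
WeaklyIncreasing {N} R = ∀ (i k : Fin N) → i ≤ᶠ k → lookup R i ≤ lookup R k

AllRowsNonpos : ∀ {N} → Vec ℤ N → Vec ℤ N → Set
AllRowsNonpos b R = ∀ (j : ℤ) → rowCount b R j ≤ 0ℤ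

VIBStep : ∀ {N} → Vec ℤ N → Vec ℤ N → Vec ℤ N → Set
VIBStep {N} b R R' =
  Σ ℤ λ j → Σ (Fin N) λ i →
    (0ℤ < rowCount b R j) ×
    (∀ (j' : ℤ) → j' < j → rowCount b R j' ≤ 0ℤ) ×
    (lookup R i ≡ j) ×
    (∀ (i' : Fin N) → i <ᶠ i' → lookup R i' ≢ j) ×
    (R' ≡ updateAt R i (λ r → r + 1ℤ))

data VIBRuns {N} (b : Vec ℤ N) : Vec ℤ N → Vec ℤ N → Set where
  stop : ∀ {R} → AllRowsNonpos b R → VIBRuns b R R
  step : ∀ {R R' R''} → ¬ AllRowsNonpos b R → VIBStep b R R' → VIBRuns b R' R'' → VIBRuns b R R''

-- A step of Algorithm VIB never overshoots a weakly increasing S ⪰ R whose row counts are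
-- all ≤ 0. Indeed, if the raised arrow A_i (the rightmost one starting at the lowest positive
-- row j) had s_i = r_i = j, then every arrow starting at a level ≤ j in T(D,R) would also do
-- so in T(D,S): those left of i because S is increasing, and there are none right of i because
-- R is increasing and i is rightmost. Raising arrows without moving any start across level j
-- can only increase their contributions to row j, so 0 < c_R(j) ≤ c_S(j) ≤ 0. Hence every
-- run of VIB stays below every such S.
-- The run from R terminates, being bounded by R̃, and outputs some X ⪯ R̃; the run from
-- R⁽⁰⁾ ⪯ R ⪯ X is bounded by X, so R̃ ⪯ X as well.
module Submission where

open import Defs
open import Data.Nat using (ℕ; zero; suc; z≤n; s≤s)
import Data.Nat as ℕ
import Data.Nat.Properties as ℕ
open import Data.Nat.Induction using (<-wellFounded)
open import Induction.WellFounded using (Acc; acc)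
open import Data.Integer
  using (ℤ; +_; -[1+_]; 0ℤ; 1ℤ; -1ℤ; _+_; _-_; -_; pred; _≤_; _<_; _≤?_; _<?_; _≟_; _⊔_; ∣_∣; +≤+; -≤+)
open import Data.Integer.Properties
  using (≤-refl; ≤-trans; ≤-reflexive; ≤-antisym; <⇒≤; ≤∧≢⇒<; <⇒≱; ≰⇒>; ≮⇒≥; <-≤-trans;
         +-comm; +-identityʳ; +-inverseˡ; +-inverseʳ; +-monoʳ-≤; +-monoˡ-≤; +-mono-≤; neg-mono-≤;
         i≤pred[j]⇒i<j; i<j⇒i≤pred[j]; i<j⇒suc[i]≤j; i≤i⊔j; i≤j⊔i; i≤j⇒0≤j-i; i-j≤i; i≤i+j)
open import Data.Integer.Tactic.RingSolver using (solve-∀)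
open import Data.Fin using (Fin; zero; suc; toℕ) renaming (_<_ to _<ᶠ_)
import Data.Fin.Properties as Fin
open import Data.Vec using (Vec; []; _∷_; lookup; updateAt)
open import Data.Vec.Properties using (lookup∘updateAt; lookup∘updateAt′; tabulate∘lookup; tabulate-cong)
open import Data.Bool using (true; false; if_then_else_; _∧_)
open import Data.Product using (Σ; _×_; _,_; proj₁; proj₂; map₂)
open import Data.Sum using (_⊎_; inj₁; inj₂)
open import Data.Empty using (⊥-elim)
open import Relation.Nullary using (¬_; does; yes; no)
open import Relation.Binary.PropositionalEquality using (_≡_; _≢_; refl; sym; trans; cong; subst; subst₂)

private variable
  N : ℕ
  b r s x y j j' : ℤ

x-1≡pred[x] : ∀ x → x - 1ℤ ≡ pred x
x-1≡pred[x] x = +-comm x -1ℤ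

≤[x-1]⇒< : j ≤ x - 1ℤ → j < x
≤[x-1]⇒< {j} {x} j≤x-1 = i≤pred[j]⇒i<j (subst (j ≤_) (x-1≡pred[x] x) j≤x-1)

<⇒≤[x-1] : j < x → j ≤ x - 1ℤ
<⇒≤[x-1] {j} {x} j<x = subst (j ≤_) (sym (x-1≡pred[x] x)) (i<j⇒i≤pred[j] j<x)

<⇒+1≤ : x < y → x + 1ℤ ≤ y
<⇒+1≤ {x} {y} x<y = subst (_≤ y) (+-comm 1ℤ x) (i<j⇒suc[i]≤j x<y)

neg[x-y]≡y-x : ∀ x y → - (x - y) ≡ y - x
neg[x-y]≡y-x = solve-∀

x-y≡x-[y+1]+1 : ∀ x y → x - y ≡ (x - (y + 1ℤ)) + 1ℤ
x-y≡x-[y+1]+1 = solve-∀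

x≤x+pos : 0ℤ < y → x ≤ x + y
x≤x+pos {y} {x} 0<y = subst (_≤ x + y) (+-identityʳ x) (+-monoʳ-≤ x (<⇒≤ 0<y))

x+neg≤x : y < 0ℤ → x + y ≤ x
x+neg≤x {y} {x} y<0 = subst (x + y ≤_) (+-identityʳ x) (+-monoʳ-≤ x (<⇒≤ y<0))

-y≤x⇒0≤x+y : - y ≤ x → 0ℤ ≤ x + y
-y≤x⇒0≤x+y {y} {x} -y≤x = subst (_≤ x + y) (+-inverseˡ y) (+-monoˡ-≤ y -y≤x)

x≤+∣x∣ : ∀ x → x ≤ + ∣ x ∣
x≤+∣x∣ (+ n) = ≤-refl
x≤+∣x∣ -[1+ n ] = -≤+

𝟙[_≤_] : ℤ → ℤ → ℤ
𝟙[ x ≤ j ] = if does (x ≤? j) then 1ℤ else 0ℤ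

𝟙-below : j < x → 𝟙[ x ≤ j ] ≡ 0ℤ
𝟙-below {j} {x} j<x with x ≤? j
... | yes x≤j = ⊥-elim (<⇒≱ j<x x≤j)
... | no _ = refl

𝟙-above : x ≤ j → 𝟙[ x ≤ j ] ≡ 1ℤ
𝟙-above {x} {j} x≤j with x ≤? j
... | yes _ = refl
... | no x≰j = ⊥-elim (x≰j x≤j)

𝟙-nonneg : ∀ x j → 0ℤ ≤ 𝟙[ x ≤ j ]
𝟙-nonneg x j with x ≤? j
... | yes _ = +≤+ z≤n
... | no _ = ≤-refl

𝟙-antitone : x ≤ y → 𝟙[ y ≤ j ] ≤ 𝟙[ x ≤ j ]
𝟙-antitone {x} {y} {j} x≤y with y ≤? j
... | no _ = 𝟙-nonneg x j
... | yes y≤j rewrite 𝟙-above (≤-trans x≤y y≤j) = ≤-refl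

𝟙-monotone : j ≤ j' → 𝟙[ x ≤ j ] ≤ 𝟙[ x ≤ j' ]
𝟙-monotone {j} {j'} {x} j≤j' with x ≤? j
... | no _ = 𝟙-nonneg x j'
... | yes x≤j rewrite 𝟙-above (≤-trans x≤j j≤j') = ≤-refl

interval≡𝟙-𝟙 : ∀ x y j → x ≤ y →
  (if does (x ≤? j) ∧ does (j ≤? y - 1ℤ) then 1ℤ else 0ℤ) ≡ 𝟙[ x ≤ j ] - 𝟙[ y ≤ j ]
interval≡𝟙-𝟙 x y j x≤y with x ≤? j | j ≤? y - 1ℤ | y ≤? j
... | yes _   | yes j<y | yes y≤j = ⊥-elim (<⇒≱ (≤[x-1]⇒< j<y) y≤j)
... | yes _   | yes _   | no _    = refl
... | yes _   | no _    | yes _   = refl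
... | yes _   | no j≮y  | no y≰j  = ⊥-elim (y≰j (≮⇒≥ λ j<y → j≮y (<⇒≤[x-1] j<y)))
... | no x≰j  | _       | yes y≤j = ⊥-elim (x≰j (≤-trans x≤y y≤j))
... | no _    | _       | no _    = refl

if-neg : ∀ c → (if c then -1ℤ else 0ℤ) ≡ - (if c then 1ℤ else 0ℤ)
if-neg true = refl
if-neg false = refl

segment≡𝟙-𝟙 : ∀ b r j → segment b r j ≡ 𝟙[ r ≤ j ] - 𝟙[ r + b ≤ j ]
segment≡𝟙-𝟙 b r j with 0ℤ <? b
... | yes 0<b = interval≡𝟙-𝟙 r (r + b) j (x≤x+pos 0<b)
... | no 0≮b with b <? 0ℤ
...   | yes b<0 = trans (if-neg _)
                    (trans (cong -_ (interval≡𝟙-𝟙 (r + b) r j (x+neg≤x b<0)))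
                           (neg[x-y]≡y-x 𝟙[ r + b ≤ j ] 𝟙[ r ≤ j ]))
...   | no b≮0 rewrite ≤-antisym (≮⇒≥ 0≮b) (≮⇒≥ b≮0) | +-identityʳ r = sym (+-inverseʳ 𝟙[ r ≤ j ])

segment-monoʳ : ∀ b → r ≤ s → (r ≤ j → s ≤ j) → segment b r j ≤ segment b s j
segment-monoʳ {r} {s} {j} b r≤s r≤j⇒s≤j rewrite segment≡𝟙-𝟙 b r j | segment≡𝟙-𝟙 b s j =
  +-mono-≤ (≤-reflexive same-start) (neg-mono-≤ (𝟙-antitone (+-monoˡ-≤ b r≤s)))
  where
  same-start : 𝟙[ r ≤ j ] ≡ 𝟙[ s ≤ j ]
  same-start with r ≤? j | s ≤? j
  ... | yes _   | yes _   = refl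
  ... | yes r≤j | no s≰j  = ⊥-elim (s≰j (r≤j⇒s≤j r≤j))
  ... | no r≰j  | yes s≤j = ⊥-elim (r≰j (≤-trans r≤s s≤j))
  ... | no _    | no _    = refl

segment-≤-row-below : ∀ b → r ≢ j → segment b r j ≤ segment b r (j - 1ℤ)
segment-≤-row-below {r} {j} b r≢j rewrite segment≡𝟙-𝟙 b r j | segment≡𝟙-𝟙 b r (j - 1ℤ) =
  +-mono-≤ start≤ (neg-mono-≤ (𝟙-monotone {x = r + b} (i-j≤i j 1ℤ)))
  where
  start≤ : 𝟙[ r ≤ j ] ≤ 𝟙[ r ≤ j - 1ℤ ]
  start≤ with r ≤? j
  ... | no _ = 𝟙-nonneg r (j - 1ℤ)
  ... | yes r≤j rewrite 𝟙-above (<⇒≤[x-1] (≤∧≢⇒< r≤j r≢j)) = ≤-refl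

segment-below : ∀ b → j < r → j < r + b → segment b r j ≤ 0ℤ
segment-below {j} {r} b j<r j<r+b rewrite segment≡𝟙-𝟙 b r j | 𝟙-below j<r | 𝟙-below j<r+b = ≤-refl

segment-above : ∀ b → r ≤ j → r + b ≤ j → segment b r j ≤ 0ℤ
segment-above {r} {j} b r≤j r+b≤j rewrite segment≡𝟙-𝟙 b r j | 𝟙-above r≤j | 𝟙-above r+b≤j = ≤-refl

rowCount-mono : ∀ (b R S : Vec ℤ N) →
  (∀ k → segment (lookup b k) (lookup R k) j ≤ segment (lookup b k) (lookup S k) j') →
  rowCount b R j ≤ rowCount b S j'
rowCount-mono [] [] [] _ = ≤-refl
rowCount-mono (_ ∷ b) (_ ∷ R) (_ ∷ S) seg≤ = +-mono-≤ (seg≤ zero) (rowCount-mono b R S (λ k → seg≤ (suc k)))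

rowCount-nonpos : ∀ (b R : Vec ℤ N) → (∀ k → segment (lookup b k) (lookup R k) j ≤ 0ℤ) → rowCount b R j ≤ 0ℤ
rowCount-nonpos [] [] _ = ≤-refl
rowCount-nonpos (_ ∷ b) (_ ∷ R) seg≤0 = +-mono-≤ (seg≤0 zero) (rowCount-nonpos b R (λ k → seg≤0 (suc k)))

rowCount-≤-row-below : ∀ (b R : Vec ℤ N) → (∀ k → lookup R k ≢ j) → rowCount b R j ≤ rowCount b R (j - 1ℤ)
rowCount-≤-row-below b R none = rowCount-mono b R R (λ k → segment-≤-row-below (lookup b k) (none k))

canonGo-lowerBounds : ∀ a (b : Vec ℤ N) i →
  a ≤ lookup (canonGo a b) i × - lookup b i ≤ lookup (canonGo a b) i
canonGo-lowerBounds a (x ∷ b) zero = i≤i⊔j a (- x) , i≤j⊔i a (- x)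
canonGo-lowerBounds a (x ∷ b) (suc i) =
  ≤-trans (i≤i⊔j a (- x)) (proj₁ (canonGo-lowerBounds (a ⊔ - x) b i)) ,
  proj₂ (canonGo-lowerBounds (a ⊔ - x) b i)

canonGo-increasing : ∀ a (b : Vec ℤ N) → WeaklyIncreasing (canonGo a b)
canonGo-increasing a (x ∷ b) zero zero _ = ≤-refl
canonGo-increasing a (x ∷ b) zero (suc k) _ = proj₁ (canonGo-lowerBounds (a ⊔ - x) b k)
canonGo-increasing a (x ∷ b) (suc i) (suc k) (s≤s i≤k) = canonGo-increasing (a ⊔ - x) b i k i≤k

-- Since R⁽⁰⁾ ⪯ R, every arrow of T(D,R) starts and ends at a nonnegative level.
rowCount-negative : ∀ (b R : Vec ℤ N) → canonical b ⪯ R → j < 0ℤ → rowCount b R j ≤ 0ℤ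
rowCount-negative b R R₀⪯R j<0 = rowCount-nonpos b R λ k →
  let (0≤R₀ , -b≤R₀) = canonGo-lowerBounds 0ℤ b k
  in segment-below (lookup b k) (<-≤-trans j<0 (≤-trans 0≤R₀ (R₀⪯R k)))
                   (<-≤-trans j<0 (-y≤x⇒0≤x+y (≤-trans -b≤R₀ (R₀⪯R k))))

height : Vec ℤ N → Vec ℤ N → ℕ
height [] [] = 0
height (b ∷ bs) (r ∷ R) = ∣ r ∣ ℕ.⊔ ∣ r + b ∣ ℕ.⊔ height bs R

height-bounds : ∀ (b R : Vec ℤ N) k →
  lookup R k ≤ + height b R × lookup R k + lookup b k ≤ + height b R
height-bounds (b ∷ bs) (r ∷ R) zero =
  ≤-trans (x≤+∣x∣ r) (+≤+ (ℕ.≤-trans (ℕ.m≤m⊔n ∣ r ∣ ∣ r + b ∣) (ℕ.m≤m⊔n _ _))) ,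
  ≤-trans (x≤+∣x∣ (r + b)) (+≤+ (ℕ.≤-trans (ℕ.m≤n⊔m ∣ r ∣ ∣ r + b ∣) (ℕ.m≤m⊔n _ _)))
height-bounds (b ∷ bs) (r ∷ R) (suc k) =
  let (start≤ , end≤) = height-bounds bs R k
  in ≤-trans start≤ (+≤+ (ℕ.m≤n⊔m _ _)) , ≤-trans end≤ (+≤+ (ℕ.m≤n⊔m _ _))

rowCount-high : ∀ (b R : Vec ℤ N) → + height b R ≤ j → rowCount b R j ≤ 0ℤ
rowCount-high b R h≤j = rowCount-nonpos b R λ k →
  let (start≤ , end≤) = height-bounds b R k
  in segment-above (lookup b k) (≤-trans start≤ h≤j) (≤-trans end≤ h≤j)

LowestPositive : (ℤ → ℤ) → Set
LowestPositive f = Σ ℤ λ j → 0ℤ < f j × (∀ j' → j' < j → f j' ≤ 0ℤ)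

lowestPositive-upTo : ∀ (f : ℤ → ℤ) → (∀ j → j < 0ℤ → f j ≤ 0ℤ) → ∀ n →
  (∀ j → j < + n → f j ≤ 0ℤ) ⊎ LowestPositive f
lowestPositive-upTo f neg≤0 zero = inj₁ neg≤0
lowestPositive-upTo f neg≤0 (suc n) with lowestPositive-upTo f neg≤0 n
... | inj₂ lowest = inj₂ lowest
... | inj₁ below≤0 with f (+ n) ≤? 0ℤ
...   | no fn≰0 = inj₂ (+ n , ≰⇒> fn≰0 , below≤0)
...   | yes fn≤0 = inj₁ below[1+n]≤0
  where
  below[1+n]≤0 : ∀ j → j < + suc n → f j ≤ 0ℤ
  below[1+n]≤0 j j<1+n with j <? + n
  ... | yes j<n = below≤0 j j<n
  ... | no j≮n rewrite ≤-antisym (i<j⇒i≤pred[j] j<1+n) (≮⇒≥ j≮n) = fn≤0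

lowestPositive? : ∀ (f : ℤ → ℤ) M → (∀ j → j < 0ℤ → f j ≤ 0ℤ) → (∀ j → + M ≤ j → f j ≤ 0ℤ) →
  (∀ j → f j ≤ 0ℤ) ⊎ LowestPositive f
lowestPositive? f M neg≤0 high≤0 with lowestPositive-upTo f neg≤0 M
... | inj₂ lowest = inj₂ lowest
... | inj₁ below≤0 = inj₁ all≤0
  where
  all≤0 : ∀ j → f j ≤ 0ℤ
  all≤0 j with j <? + M
  ... | yes j<M = below≤0 j j<M
  ... | no j≮M = high≤0 j (≮⇒≥ j≮M)

IsRightmostAt : Vec ℤ N → ℤ → Fin N → Set
IsRightmostAt R j i = lookup R i ≡ j × (∀ i' → i <ᶠ i' → lookup R i' ≢ j)

rightmostAt? : ∀ (R : Vec ℤ N) j → Σ (Fin N) (IsRightmostAt R j) ⊎ (∀ k → lookup R k ≢ j)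
rightmostAt? [] j = inj₂ λ ()
rightmostAt? (r ∷ R) j with rightmostAt? R j
... | inj₁ (i , Ri≡j , rightmost) = inj₁ (suc i , Ri≡j , λ { (suc i') (s≤s i<i') → rightmost i' i<i' })
... | inj₂ none with r ≟ j
...   | yes r≡j = inj₁ (zero , r≡j , λ { (suc i') _ → none i' })
...   | no r≢j = inj₂ λ { zero → r≢j ; (suc k) → none k }

raise : Vec ℤ N → Fin N → Vec ℤ N
raise R i = updateAt R i (_+ 1ℤ)

vibStep? : ∀ (b R : Vec ℤ N) → canonical b ⪯ R → AllRowsNonpos b R ⊎ Σ (Vec ℤ N) (VIBStep b R)
vibStep? b R R₀⪯R
  with lowestPositive? (rowCount b R) (height b R)
         (λ _ → rowCount-negative b R R₀⪯R) (λ _ → rowCount-high b R)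
... | inj₁ all≤0 = inj₁ all≤0
... | inj₂ (j , 0<c , lowest) with rightmostAt? R j
...   | inj₁ (i , Ri≡j , rightmost) = inj₂ (raise R i , j , i , 0<c , lowest , Ri≡j , rightmost , refl)
...   | inj₂ none =
  ⊥-elim (<⇒≱ 0<c (≤-trans (rowCount-≤-row-below b R none) (lowest (j - 1ℤ) (≤[x-1]⇒< ≤-refl))))

vibStep⇒¬stop : ∀ (b R : Vec ℤ N) {R'} → VIBStep b R R' → ¬ AllRowsNonpos b R
vibStep⇒¬stop _ _ (j , _ , 0<c , _) R-stop = <⇒≱ 0<c (R-stop j)

raise-at : ∀ (R : Vec ℤ N) i → lookup (raise R i) i ≡ lookup R i + 1ℤ
raise-at R i = lookup∘updateAt i R

raise-elsewhere : ∀ (R : Vec ℤ N) {i k} → k ≢ i → lookup (raise R i) k ≡ lookup R k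
raise-elsewhere R {i} {k} k≢i = lookup∘updateAt′ k i k≢i R

⪯-raise : ∀ (R : Vec ℤ N) i → R ⪯ raise R i
⪯-raise R i k with k Fin.≟ i
... | yes refl = ≤-trans (i≤i+j (lookup R k) 1ℤ) (≤-reflexive (sym (raise-at R k)))
... | no k≢i = ≤-reflexive (sym (raise-elsewhere R k≢i))

raise-⪯ : ∀ (R S : Vec ℤ N) i → R ⪯ S → lookup R i < lookup S i → raise R i ⪯ S
raise-⪯ R S i R⪯S Ri<Si k with k Fin.≟ i
... | yes refl = subst (_≤ lookup S k) (sym (raise-at R k)) (<⇒+1≤ Ri<Si)
... | no k≢i = subst (_≤ lookup S k) (sym (raise-elsewhere R k≢i)) (R⪯S k)

raise-increasing : ∀ (R : Vec ℤ N) i {j} →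
  WeaklyIncreasing R → IsRightmostAt R j i → WeaklyIncreasing (raise R i)
raise-increasing R i R-inc (Ri≡j , rightmost) k k' k≤k' with k Fin.≟ i | k' Fin.≟ i
... | yes refl | yes refl = ≤-refl
... | yes refl | no k'≢k =
  subst₂ _≤_ (sym (raise-at R k)) (sym (raise-elsewhere R k'≢k))
    (<⇒+1≤ (≤∧≢⇒< (R-inc k k' k≤k') λ Rk≡Rk' → rightmost k' k<k' (trans (sym Rk≡Rk') Ri≡j)))
  where
  k<k' : k <ᶠ k'
  k<k' = Fin.≤∧≢⇒< k≤k' λ k≡k' → k'≢k (sym k≡k')
... | no k≢k' | yes refl =
  subst₂ _≤_ (sym (raise-elsewhere R k≢k')) (sym (raise-at R k')) (≤-trans (R-inc k k' k≤k') (i≤i+j _ 1ℤ))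
... | no k≢i | no k'≢i =
  subst₂ _≤_ (sym (raise-elsewhere R k≢i)) (sym (raise-elsewhere R k'≢i)) (R-inc k k' k≤k')

levels-≤-preserved : ∀ (R S : Vec ℤ N) i {j} → WeaklyIncreasing R → WeaklyIncreasing S →
  IsRightmostAt R j i → lookup S i ≡ j → ∀ k → lookup R k ≤ j → lookup S k ≤ j
levels-≤-preserved R S i R-inc S-inc (Ri≡j , rightmost) Si≡j k Rk≤j with toℕ k ℕ.≤? toℕ i
... | yes k≤i = ≤-trans (S-inc k i k≤i) (≤-reflexive Si≡j)
... | no k≰i = ⊥-elim (rightmost k i<k (≤-antisym Rk≤j (subst (_≤ lookup R k) Ri≡j (R-inc i k (ℕ.<⇒≤ i<k)))))
  where
  i<k : i <ᶠ k
  i<k = ℕ.≰⇒> k≰i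

vibStep-⪯ : ∀ (b R : Vec ℤ N) {R'} → VIBStep b R R' → R ⪯ R'
vibStep-⪯ _ R (_ , i , _ , _ , _ , _ , refl) = ⪯-raise R i

vibStep-increasing : ∀ (b R : Vec ℤ N) {R'} → WeaklyIncreasing R → VIBStep b R R' → WeaklyIncreasing R'
vibStep-increasing _ R R-inc (_ , i , _ , _ , Ri≡j , rightmost , refl) =
  raise-increasing R i R-inc (Ri≡j , rightmost)

vibStep-bounded : ∀ (b R S : Vec ℤ N) {R'} → WeaklyIncreasing R → WeaklyIncreasing S → R ⪯ S →
  AllRowsNonpos b S → VIBStep b R R' → R' ⪯ S
vibStep-bounded b R S R-inc S-inc R⪯S S-stop (j , i , 0<c , _ , Ri≡j , rightmost , refl) =
  raise-⪯ R S i R⪯S (≤∧≢⇒< (R⪯S i) λ Ri≡Si →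
    <⇒≱ 0<c (≤-trans (row-j-grows (trans (sym Ri≡Si) Ri≡j)) (S-stop j)))
  where
  row-j-grows : lookup S i ≡ j → rowCount b R j ≤ rowCount b S j
  row-j-grows Si≡j = rowCount-mono b R S λ k →
    segment-monoʳ (lookup b k) (R⪯S k) (levels-≤-preserved R S i R-inc S-inc (Ri≡j , rightmost) Si≡j k)

⪯-antisym : ∀ (R S : Vec ℤ N) → R ⪯ S → S ⪯ R → R ≡ S
⪯-antisym R S R⪯S S⪯R =
  trans (sym (tabulate∘lookup R)) (trans (tabulate-cong λ k → ≤-antisym (R⪯S k) (S⪯R k)) (tabulate∘lookup S))

vibRuns-increasing : ∀ {b R X : Vec ℤ N} → VIBRuns b R X → WeaklyIncreasing R → WeaklyIncreasing X
vibRuns-increasing (stop _) R-inc = R-inc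
vibRuns-increasing {b = b} (step {R} _ st run) R-inc =
  vibRuns-increasing run (vibStep-increasing b R R-inc st)

vibRuns-final : ∀ {b R X : Vec ℤ N} → VIBRuns b R X → AllRowsNonpos b X
vibRuns-final (stop X-stop) = X-stop
vibRuns-final (step _ _ run) = vibRuns-final run

vibRuns-⪯ : ∀ {b R X : Vec ℤ N} → VIBRuns b R X → R ⪯ X
vibRuns-⪯ (stop _) _ = ≤-refl
vibRuns-⪯ {b = b} (step {R} _ st run) k = ≤-trans (vibStep-⪯ b R st k) (vibRuns-⪯ run k)

vibRuns-bounded : ∀ {b R X S : Vec ℤ N} → VIBRuns b R X → WeaklyIncreasing R → WeaklyIncreasing S →
  R ⪯ S → AllRowsNonpos b S → X ⪯ S
vibRuns-bounded (stop _) _ _ R⪯S _ = R⪯S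
vibRuns-bounded {b = b} {S = S} (step {R} _ st run) R-inc S-inc R⪯S S-stop =
  vibRuns-bounded run (vibStep-increasing b R R-inc st) S-inc
    (vibStep-bounded b R S R-inc S-inc R⪯S S-stop st) S-stop

gap : Vec ℤ N → Vec ℤ N → ℕ
gap [] [] = 0
gap (s ∷ S) (r ∷ R) = ∣ s - r ∣ ℕ.+ gap S R

∣x-[y+1]∣<∣x-y∣ : y + 1ℤ ≤ x → ∣ x - (y + 1ℤ) ∣ ℕ.< ∣ x - y ∣
∣x-[y+1]∣<∣x-y∣ {y} {x} y+1≤x with x - (y + 1ℤ) | i≤j⇒0≤j-i y+1≤x | x-y≡x-[y+1]+1 x y
... | + n | _ | x-y≡n+1 rewrite x-y≡n+1 = ℕ.m<m+n n (s≤s z≤n)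

gap-raise : ∀ (S R : Vec ℤ N) i → raise R i ⪯ S → gap S (raise R i) ℕ.< gap S R
gap-raise (s ∷ S) (r ∷ R) zero R'⪯S = ℕ.+-monoˡ-< (gap S R) (∣x-[y+1]∣<∣x-y∣ (R'⪯S zero))
gap-raise (s ∷ S) (r ∷ R) (suc i) R'⪯S = ℕ.+-monoʳ-< ∣ s - r ∣ (gap-raise S R i (λ k → R'⪯S (suc k)))

vibStep-gap : ∀ (b R S : Vec ℤ N) {R'} → VIBStep b R R' → R' ⪯ S → gap S R' ℕ.< gap S R
vibStep-gap _ R S (_ , i , _ , _ , _ , _ , refl) = gap-raise S R i

vibRuns-exists : ∀ (b S R : Vec ℤ N) → WeaklyIncreasing S → AllRowsNonpos b S →
  WeaklyIncreasing R → canonical b ⪯ R → R ⪯ S → Σ (Vec ℤ N) (VIBRuns b R)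
vibRuns-exists {N} b S R S-inc S-stop = go R (<-wellFounded (gap S R))
  where
  go : ∀ R → Acc ℕ._<_ (gap S R) → WeaklyIncreasing R → canonical b ⪯ R → R ⪯ S → Σ (Vec ℤ N) (VIBRuns b R)
  go R (acc smaller) R-inc R₀⪯R R⪯S with vibStep? b R R₀⪯R
  ... | inj₁ R-stop = R , stop R-stop
  ... | inj₂ (R' , st) =
    map₂ (step (vibStep⇒¬stop b R st) st)
      (go R' (smaller (vibStep-gap b R S st R'⪯S)) (vibStep-increasing b R R-inc st)
         (λ k → ≤-trans (R₀⪯R k) (vibStep-⪯ b R st k)) R'⪯S)
    where
    R'⪯S : R' ⪯ S
    R'⪯S = vibStep-bounded b R S R-inc S-inc R⪯S S-stop st

theorem2 : (N : ℕ) (b : Vec ℤ N) → IsGeneralDyck b →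
    (Rt : Vec ℤ N) → VIBRuns b (canonical b) Rt →
    (R : Vec ℤ N) → WeaklyIncreasing R → canonical b ⪯ R → R ⪯ Rt →
    VIBRuns b R Rt
theorem2 N b _ R̃ run₀ R R-inc R₀⪯R R⪯R̃ =
  let X , run = vibRuns-exists b R̃ R R̃-inc R̃-stop R-inc R₀⪯R R⪯R̃
      X⪯R̃ = vibRuns-bounded run R-inc R̃-inc R⪯R̃ R̃-stop
      R̃⪯X = vibRuns-bounded run₀ R₀-inc (vibRuns-increasing run R-inc)
              (λ k → ≤-trans (R₀⪯R k) (vibRuns-⪯ run k)) (vibRuns-final run)
  in subst (VIBRuns b R) (⪯-antisym X R̃ X⪯R̃ R̃⪯X) run
  where
  R₀-inc : WeaklyIncreasing (canonical b)
  R₀-inc = canonGo-increasing 0ℤ b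
  R̃-inc : WeaklyIncreasing R̃
  R̃-inc = vibRuns-increasing run₀ R₀-inc
  R̃-stop : AllRowsNonpos b R̃
  R̃-stop = vibRuns-final run₀
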